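{- For every strong generalized topological model $M'=\langle W,\tau,V\rangle$ there exists an in-fact-strong $\bullet$gtf-model $M=\langle W,\mu,\mathcal{F},V\rangle$ (same worlds, same valuation) which is pointwise equivalent to $M'$: for every $w\in W$ and every formula $\varphi$, $w\Vdash\varphi$ in $M'$ (the modality read as $\Box$) iff $w\Vdash\varphi$ in $M$ (the modality read as $\bullet$).
   Context: Formulas are built from a countable set $PV$ of propositional variables using $\bot,\lnot,\land,\lor,\to$ and one unary modality. A generalized topology on a nonempty set $W$ is a family $\mu\subseteq P(W)$ with $\emptyset\in\mu$ and closed under unions of arbitrary nonempty subfamilies; $\bigcup\mu$ is the union of its members; it is strong if $W\in\mu$. A $\bullet$gtf-model is $\langle W,\mu,\mathcal{F},V\rangle$ where $\mu$ is a generalized topology on $W$, $V:PV\to P(W)$, and $\mathcal{F}:W\to P(P(\bigcup\mu))$ satisfies: if $w\in\bigcup\mu$ then $X\in\mathcal{F}_w$ iff ($X\in\mu$ and $w\in X$); if $w\notin\bigcup\mu$ then $\mathcal{F}_w\subseteq\mu$. For $A\in\mu$ put $A^{ -1}=\{z\in W:A\in\mathcal{F}_z\}$. Satisfaction: Boolean clauses classical, $w\Vdash q$ iff $w\in V(q)$, and $w\Vdash\bullet\varphi$ iff there is $O\in\mathcal{F}_w$ with $v\Vdash\varphi$ for all $v\in O^{ -1}$. It is in-fact-strong if for every $w\in W\setminus\bigcup\mu$: (i) if $X\in\mathcal{F}_w$ and $X\subseteq Y\in\mu$ then $Y\in\mathcal{F}_w$; (ii) if $(X_i)_{i\in J}$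 is a family of members of $\mu$ with $\bigcup_{i\in J}X_i\in\mathcal{F}_w$, then there is $k\in J$ with $w\in X_k^{ -1}$; (iii) $\mathcal{F}_w\neq\emptyset$. A strong generalized topological model is $\langle W,\tau,V\rangle$ with $\tau$ a strong generalized topology on $W$ and $V:PV\to P(W)$; satisfaction: Boolean clauses classical and $w\Vdash\Box\varphi$ iff there is $X\in\tau$ with $w\in X$ and $v\Vdash\varphi$ for all $v\in X$. -}

module Defs where

open import Level using (Level; _⊔_; Lift) renaming (suc to lsuc; zero to lzero)
open import Data.Nat using (ℕ)
open import Data.Product using (Σ; _×_; _,_)
open import Data.Empty using (⊥)
open import Data.Unit using (⊤)
open import Data.Sum using (_⊎_)
open import Relation.Nullary using (¬_)
open import Function.Bundles using (_⇔_)

-- Since predicates are intensional, families are required to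
-- respect extensional equality of subsets (so they behave as sets of sets).
Sub : Set → Set₁
Sub W = W → Set

Fam : Set → Set₂
Fam W = Sub W → Set₁

module _ {W : Set} where

  _⊆_ : Sub W → Sub W → Set
  X ⊆ Y = ∀ w → X w → Y w

  _≐_ : Sub W → Sub W → Set
  X ≐ Y = (X ⊆ Y) × (Y ⊆ X)

  ∅ : Sub W
  ∅ _ = ⊥

  Full : Sub W
  Full _ = ⊤

  ⋃ᵢ : {J : Set} → (J → Sub W) → Sub W
  ⋃ᵢ {J} X w = Σ J λ j → X j w

  ⋃F : Fam W → W → Set₁
  ⋃F μ w = Σ (Sub W) λ X → μ X × X w

record IsGenTop (W : Set) (μ : Fam W) : Set₂ where
  field
    ext   : ∀ {X Y} → X ≐ Y → μ X → μ Y
    empty : μ ∅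
    union : (J : Set) → J → (X : J → Sub W) →
            (∀ j → μ (X j)) → μ (⋃ᵢ X)

record IsStrongGenTop (W : Set) (τ : Fam W) : Set₂ where
  field
    isGenTop : IsGenTop W τ
    full     : τ Full

data Form : Set where
  var  : ℕ → Form
  ⊥'   : Form
  ¬'_  : Form → Form
  _∧'_ : Form → Form → Form
  _∨'_ : Form → Form → Form
  _⇒'_ : Form → Form → Form
  ◯    : Form → Form

Valuation : Set → Set₁
Valuation W = ℕ → Sub W

record SGTModel (W : Set) : Set₂ where
  field
    τ        : Fam W
    isStrong : IsStrongGenTop W τ
    V        : Valuation W

_,_⊩□_ : {W : Set} → SGTModel W → W → Form → Set₁
M , w ⊩□ var q   = Lift (lsuc lzero) (SGTModel.V M q w)
M , w ⊩□ ⊥'      = Lift (lsuc lzero) ⊥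
M , w ⊩□ (¬' φ)  = ¬ (M , w ⊩□ φ)
M , w ⊩□ (φ ∧' ψ) = (M , w ⊩□ φ) × (M , w ⊩□ ψ)
M , w ⊩□ (φ ∨' ψ) = (M , w ⊩□ φ) ⊎ (M , w ⊩□ ψ)
M , w ⊩□ (φ ⇒' ψ) = (M , w ⊩□ φ) → (M , w ⊩□ ψ)
M , w ⊩□ ◯ φ     = Σ (Sub _) λ X → SGTModel.τ M X × X w × (∀ v → X v → M , v ⊩□ φ)

record GTFModel (W : Set) : Set₂ where
  field
    μ        : Fam W
    isGenTop : IsGenTop W μ
    F        : W → Fam W
    V        : Valuation W
    F-ext    : ∀ w {X Y} → X ≐ Y → F w X → F w Y
    F-⊆⋃     : ∀ w X → F w X → ∀ v → X v → ⋃F μ v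
    F-in     : ∀ w → ⋃F μ w → ∀ X → F w X ⇔ (μ X × X w)
    F-out    : ∀ w → ¬ ⋃F μ w → ∀ X → F w X → μ X

-- satisfaction in a •gtf-model (◯ read as •);  O⁻¹ = {z : O ∈ F_z}
_,_⊩•_ : {W : Set} → GTFModel W → W → Form → Set₁
M , w ⊩• var q   = Lift (lsuc lzero) (GTFModel.V M q w)
M , w ⊩• ⊥'      = Lift (lsuc lzero) ⊥
M , w ⊩• (¬' φ)  = ¬ (M , w ⊩• φ)
M , w ⊩• (φ ∧' ψ) = (M , w ⊩• φ) × (M , w ⊩• ψ)
M , w ⊩• (φ ∨' ψ) = (M , w ⊩• φ) ⊎ (M , w ⊩• ψ)
M , w ⊩• (φ ⇒' ψ) = (M , w ⊩• φ) → (M , w ⊩• ψ)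
M , w ⊩• ◯ φ     = Σ (Sub _) λ O → GTFModel.F M w O × (∀ v → GTFModel.F M v O → M , v ⊩• φ)

record InFactStrong {W : Set} (M : GTFModel W) : Set₂ where
  open GTFModel M
  field
    upward : ∀ w → ¬ ⋃F μ w → ∀ X Y → F w X → X ⊆ Y → μ Y → F w Y
    split  : ∀ w → ¬ ⋃F μ w → (J : Set) → (X : J → Sub W) →
             (∀ j → μ (X j)) → F w (⋃ᵢ X) → Σ J λ k → F w (X k)
    nonemp : ∀ w → ¬ ⋃F μ w → Σ (Sub W) λ X → F w X

-- Take μ = τ and let F_w be the open neighbourhoods of w.  Then O⁻¹ = O for
-- every open O, so • is read exactly as □.  Since τ is strong, every world
-- lies in ⋃τ, so the in-fact-strong conditions constrain no world at all.
module Submission where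

open import Defs
open import Data.Product using (Σ; _×_; _,_; proj₁)
open import Data.Sum using (inj₁; inj₂)
open import Data.Unit using (tt)
open import Data.Empty using (⊥-elim)
open import Function.Bundles using (_⇔_; mk⇔)
open import Relation.Binary.PropositionalEquality using (_≡_; refl)

module _ {W : Set} where

  ⋃F-member : ∀ {μ : Fam W} {X v} → μ X → X v → ⋃F μ v
  ⋃F-member {X = X} μX Xv = X , μX , Xv

  strong⇒covering : ∀ {τ} → IsStrongGenTop W τ → ∀ w → ⋃F τ w
  strong⇒covering isStrong w = ⋃F-member (IsStrongGenTop.full isStrong) tt

  neighbourhoodModel : (μ : Fam W) → IsGenTop W μ → Valuation W → GTFModel W
  neighbourhoodModel μ isGenTop V = record
    { μ        = μ
    ; isGenTop = isGenTop
    ; F        = λ w X → μ X × X w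
    ; V        = V
    ; F-ext    = λ w X≐Y (μX , Xw) → IsGenTop.ext isGenTop X≐Y μX , proj₁ X≐Y w Xw
    ; F-⊆⋃     = λ w X (μX , _) v Xv → ⋃F-member μX Xv
    ; F-in     = λ w _ X → mk⇔ (λ p → p) (λ p → p)
    ; F-out    = λ w _ X → proj₁
    }

  covering⇒inFactStrong : (M : GTFModel W) → (∀ w → ⋃F (GTFModel.μ M) w) →
                          InFactStrong M
  covering⇒inFactStrong M covering = record
    { upward = λ w w∉ → ⊥-elim (w∉ (covering w))
    ; split  = λ w w∉ → ⊥-elim (w∉ (covering w))
    ; nonemp = λ w w∉ → ⊥-elim (w∉ (covering w))
    }

module _ {W : Set} (M′ : SGTModel W) where
  open SGTModel M′

  neighbourhoodModelOf : GTFModel W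
  neighbourhoodModelOf =
    neighbourhoodModel τ (IsStrongGenTop.isGenTop isStrong) V

  private
    M = neighbourhoodModelOf

  □⇒• : ∀ w φ → M′ , w ⊩□ φ → M , w ⊩• φ
  •⇒□ : ∀ w φ → M , w ⊩• φ → M′ , w ⊩□ φ

  □⇒• w (var q)  p          = p
  □⇒• w ⊥'       p          = p
  □⇒• w (¬' φ)   ¬p q       = ¬p (•⇒□ w φ q)
  □⇒• w (φ ∧' ψ) (p , q)    = □⇒• w φ p , □⇒• w ψ q
  □⇒• w (φ ∨' ψ) (inj₁ p)   = inj₁ (□⇒• w φ p)
  □⇒• w (φ ∨' ψ) (inj₂ q)   = inj₂ (□⇒• w ψ q)
  □⇒• w (φ ⇒' ψ) f p        = □⇒• w ψ (f (•⇒□ w φ p))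
  □⇒• w (◯ φ) (X , τX , Xw , all) =
    X , (τX , Xw) , λ v (_ , Xv) → □⇒• v φ (all v Xv)

  •⇒□ w (var q)  p          = p
  •⇒□ w ⊥'       p          = p
  •⇒□ w (¬' φ)   ¬p q       = ¬p (□⇒• w φ q)
  •⇒□ w (φ ∧' ψ) (p , q)    = •⇒□ w φ p , •⇒□ w ψ q
  •⇒□ w (φ ∨' ψ) (inj₁ p)   = inj₁ (•⇒□ w φ p)
  •⇒□ w (φ ∨' ψ) (inj₂ q)   = inj₂ (•⇒□ w ψ q)
  •⇒□ w (φ ⇒' ψ) f p        = •⇒□ w ψ (f (□⇒• w φ p))
  •⇒□ w (◯ φ) (X , (τX , Xw) , all) =
    X , τX , Xw , λ v Xv → •⇒□ v φ (all v (τX , Xv))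

  □⇔• : ∀ w φ → (M′ , w ⊩□ φ) ⇔ (M , w ⊩• φ)
  □⇔• w φ = mk⇔ (□⇒• w φ) (•⇒□ w φ)

mainTheorem12 : (W : Set) → W → (M′ : SGTModel W) →
    Σ (GTFModel W) λ M →
    InFactStrong M × (GTFModel.V M ≡ SGTModel.V M′) ×
    (∀ (w : W) (φ : Form) → (M′ , w ⊩□ φ) ⇔ (M , w ⊩• φ))
mainTheorem12 W _ M′ =
    neighbourhoodModelOf M′
  , covering⇒inFactStrong (neighbourhoodModelOf M′)
      (strong⇒covering (SGTModel.isStrong M′))
  , refl
  , □⇔• M′
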